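{- Let $\mathbf A$ be a pseudo-Kleene lattice. Then $\mathbf A$ is sp-orthomodular if and only if for all $x,y\in A$: if $x\leq y$, then $y\land(x\lor x')=x\lor(x'\land y)$.
   Context: A pseudo-Kleene lattice is an algebra $(A,\land,\lor,{}',0,1)$ where $(A,\land,\lor,0,1)$ is a bounded lattice, ${}'$ is an antitone involution, and $x\land x'\leq y\lor y'$ for all $x,y$. It is sp-orthomodular if for all $x,y$: (SP1) $x\leq y$ and $x'\land y=(x\land x')\lor(y\land y')$ imply $y\land(x\lor x')=x\lor(y\land y')$; (SP2) $x\leq y$ implies $(x\land x')\lor(y\land y')=(x'\land y)\land(x'\land y)'$. -}

module Defs where

open import Level using (Level; suc; _⊔_)
open import Relation.Binary.Core using (Rel)
open import Algebra.Core using (Op₁; Op₂)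
open import Algebra.Lattice.Structures using (IsLattice)
open import Data.Product using (_×_)
open import Function.Bundles using (_⇔_)

record PseudoKleeneLattice (c ℓ : Level) : Set (suc (c ⊔ ℓ)) where
  infixr 7 _∧_
  infixr 6 _∨_
  infix  4 _≈_ _≤_
  infix  8 _′
  field
    Carrier   : Set c
    _≈_       : Rel Carrier ℓ
    _∨_       : Op₂ Carrier
    _∧_       : Op₂ Carrier
    _′        : Op₁ Carrier
    ⊥         : Carrier
    ⊤         : Carrier
    isLattice : IsLattice _≈_ _∨_ _∧_

  _≤_ : Rel Carrier ℓ
  x ≤ y = (x ∧ y) ≈ x

  field
    ′-cong      : ∀ {x y} → x ≈ y → (x ′) ≈ (y ′)
    ⊥-minimum   : ∀ x → ⊥ ≤ x
    ⊤-maximum   : ∀ x → x ≤ ⊤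
    involutive  : ∀ x → ((x ′) ′) ≈ x
    antitone    : ∀ {x y} → x ≤ y → (y ′) ≤ (x ′)
    kleene      : ∀ x y → (x ∧ (x ′)) ≤ (y ∨ (y ′))

  open IsLattice isLattice public

module _ {c ℓ : Level} (A : PseudoKleeneLattice c ℓ) where
  open PseudoKleeneLattice A

  SP1 : Set (c ⊔ ℓ)
  SP1 = ∀ x y → x ≤ y → ((x ′) ∧ y) ≈ ((x ∧ (x ′)) ∨ (y ∧ (y ′))) →
        (y ∧ (x ∨ (x ′))) ≈ (x ∨ (y ∧ (y ′)))

  SP2 : Set (c ⊔ ℓ)
  SP2 = ∀ x y → x ≤ y →
        ((x ∧ (x ′)) ∨ (y ∧ (y ′))) ≈ (((x ′) ∧ y) ∧ (((x ′) ∧ y) ′))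

  SpOrthomodular : Set (c ⊔ ℓ)
  SpOrthomodular = SP1 × SP2

{-# OPTIONS --safe #-}
-- The condition is the modular law x ∨ (z ∧ y) ≈ y ∧ (x ∨ z) for x ≤ y at z = x′, and
-- its inequality ≤ holds in every lattice. Given it, SP1 is immediate, and SP2 follows
-- from the condition for x ≤ y ∨ y′ and, read through the De Morgan laws, for y′ ≤ x′.
-- Conversely, for x ≤ y put u = y′ and v = x′ ∧ (x ∨ y′) ≈ (x ∨ (x′ ∧ y))′. Then
-- t = u′ ∧ v satisfies t ≤ t′, so SP2 turns into the hypothesis of SP1 for u ≤ v, and
-- SP1 together with SP2 for x ≤ y bound (x ∨ (x′ ∧ y))′ by (y ∧ (x ∨ x′))′.
module Submission where

open import Level using (Level; _⊔_)
open import Data.Product using (_,_)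
open import Function.Base using (_∘_)
open import Function.Bundles using (_⇔_; mk⇔)
open import Algebra.Lattice.Bundles using (Lattice)
import Algebra.Lattice.Properties.Lattice as AlgebraicLatticeProperties
import Relation.Binary.Lattice as OrderTheoretic
import Relation.Binary.Lattice.Properties.MeetSemilattice as MeetSemilatticeProperties
import Relation.Binary.Reasoning.PartialOrder as PartialOrderReasoning
open import Defs

module PseudoKleeneLatticeProperties {c ℓ : Level} (A : PseudoKleeneLattice c ℓ) where
  open PseudoKleeneLattice A

  lattice : Lattice c ℓ
  lattice = record { isLattice = isLattice }

  -- The library's natural order is x ≈ x ∧ y, the symmetric form of _≤_.
  private
    module Natural = OrderTheoretic.Lattice (AlgebraicLatticeProperties.∨-∧-orderTheoreticLattice lattice)

  ≤-isLattice : OrderTheoretic.IsLattice _≈_ _≤_ _∨_ _∧_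
  ≤-isLattice = record
    { isPartialOrder = record
      { isPreorder = record
        { isEquivalence = isEquivalence
        ; reflexive     = sym ∘ Natural.reflexive
        ; trans         = λ p q → sym (Natural.trans (sym p) (sym q))
        }
      ; antisym = λ p q → Natural.antisym (sym p) (sym q)
      }
    ; supremum = λ x y → let ub₁ , ub₂ , lub = Natural.supremum x y in
        sym ub₁ , sym ub₂ , λ z p q → sym (lub z (sym p) (sym q))
    ; infimum  = λ x y → let lb₁ , lb₂ , glb = Natural.infimum x y in
        sym lb₁ , sym lb₂ , λ z p q → sym (glb z (sym p) (sym q))
    }

  orderLattice : OrderTheoretic.Lattice c ℓ ℓ
  orderLattice = record { isLattice = ≤-isLattice }

  open OrderTheoretic.Lattice orderLattice public
    using (poset; meetSemilattice; x≤x∨y; y≤x∨y; ∨-least; x∧y≤x; x∧y≤y; ∧-greatest)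
    renaming (trans to ≤-trans; antisym to ≤-antisym; reflexive to ≤-reflexive)

  open MeetSemilatticeProperties meetSemilattice public using (∧-monotonic)
  open PartialOrderReasoning poset

  modular-≤ : ∀ {x y} z → x ≤ y → x ∨ (z ∧ y) ≤ y ∧ (x ∨ z)
  modular-≤ {x} {y} z x≤y = ∨-least
    (∧-greatest x≤y (x≤x∨y x z))
    (∧-greatest (x∧y≤y z y) (≤-trans (x∧y≤x z y) (y≤x∨y x z)))

  ≤-′-swap : ∀ {x y} → x ≤ y ′ → y ≤ x ′
  ≤-′-swap {x} {y} x≤y′ = begin
    y     ≈⟨ involutive y ⟨
    y ′ ′ ≤⟨ antitone x≤y′ ⟩
    x ′   ∎

  ′-reflects-≤ : ∀ {x y} → x ′ ≤ y ′ → y ≤ x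
  ′-reflects-≤ {x} {y} x′≤y′ = begin
    y     ≤⟨ ≤-′-swap x′≤y′ ⟩
    x ′ ′ ≈⟨ involutive x ⟩
    x     ∎

  ′-distrib-∨ : ∀ x y → (x ∨ y) ′ ≈ x ′ ∧ y ′
  ′-distrib-∨ x y = ≤-antisym
    (∧-greatest (antitone (x≤x∨y x y)) (antitone (y≤x∨y x y)))
    (≤-′-swap (∨-least (≤-′-swap (x∧y≤x (x ′) (y ′))) (≤-′-swap (x∧y≤y (x ′) (y ′)))))

  ′-distrib-∧ : ∀ x y → (x ∧ y) ′ ≈ x ′ ∨ y ′
  ′-distrib-∧ x y = begin-equality
    (x ∧ y) ′         ≈⟨ ′-cong (∧-cong (involutive x) (involutive y)) ⟨
    (x ′ ′ ∧ y ′ ′) ′ ≈⟨ ′-cong (′-distrib-∨ (x ′) (y ′)) ⟨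
    (x ′ ∨ y ′) ′ ′   ≈⟨ involutive (x ′ ∨ y ′) ⟩
    x ′ ∨ y ′         ∎

  [x∨x′]′≈x∧x′ : ∀ x → (x ∨ x ′) ′ ≈ x ∧ x ′
  [x∨x′]′≈x∧x′ x = begin-equality
    (x ∨ x ′) ′ ≈⟨ ′-distrib-∨ x (x ′) ⟩
    x ′ ∧ x ′ ′ ≈⟨ ∧-congˡ (involutive x) ⟩
    x ′ ∧ x     ≈⟨ ∧-comm (x ′) x ⟩
    x ∧ x ′     ∎

  [x′∧y]′≈x∨y′ : ∀ x y → (x ′ ∧ y) ′ ≈ x ∨ y ′
  [x′∧y]′≈x∨y′ x y = trans (′-distrib-∧ (x ′) y) (∨-congʳ (involutive x))

  [y∧[x∨x′]]′≈y′∨[x∧x′] : ∀ x y → (y ∧ (x ∨ x ′)) ′ ≈ y ′ ∨ (x ∧ x ′)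
  [y∧[x∨x′]]′≈y′∨[x∧x′] x y = trans (′-distrib-∧ y (x ∨ x ′)) (∨-congˡ ([x∨x′]′≈x∧x′ x))

  [x∨[x′∧y]]′≈x′∧[x∨y′] : ∀ x y → (x ∨ (x ′ ∧ y)) ′ ≈ x ′ ∧ (x ∨ y ′)
  [x∨[x′∧y]]′≈x′∧[x∨y′] x y = trans (′-distrib-∨ x (x ′ ∧ y)) (∧-congˡ ([x′∧y]′≈x∨y′ x y))

  ≤-[x′∧y]′ : ∀ {x y z} → z ≤ x ∨ y ′ → z ≤ (x ′ ∧ y) ′
  ≤-[x′∧y]′ {x} {y} z≤x∨y′ = ≤-trans z≤x∨y′ (≤-reflexive (sym ([x′∧y]′≈x∨y′ x y)))

  [x∧x′]∨[y∧y′]≤[x′∧y]∧[x′∧y]′ : ∀ {x y} → x ≤ y →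
    (x ∧ x ′) ∨ (y ∧ y ′) ≤ (x ′ ∧ y) ∧ (x ′ ∧ y) ′
  [x∧x′]∨[y∧y′]≤[x′∧y]∧[x′∧y]′ {x} {y} x≤y = ∨-least
    (∧-greatest
      (∧-greatest (x∧y≤y x (x ′)) (≤-trans (x∧y≤x x (x ′)) x≤y))
      (≤-[x′∧y]′ (≤-trans (x∧y≤x x (x ′)) (x≤x∨y x (y ′)))))
    (∧-greatest
      (∧-greatest (≤-trans (x∧y≤y y (y ′)) (antitone x≤y)) (x∧y≤x y (y ′)))
      (≤-[x′∧y]′ (≤-trans (x∧y≤y y (y ′)) (y≤x∨y x (y ′)))))

  ComplementModular : Set (c ⊔ ℓ)
  ComplementModular = ∀ x y → x ≤ y → y ∧ (x ∨ x ′) ≈ x ∨ (x ′ ∧ y)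

  module _ (modular : ComplementModular) where

    modular-′ : ∀ {x y} → x ≤ y → x ′ ∧ (x ∨ y ′) ≈ y ′ ∨ (x ∧ x ′)
    modular-′ {x} {y} x≤y = begin-equality
      x ′ ∧ (x ∨ y ′)   ≈⟨ [x∨[x′∧y]]′≈x′∧[x∨y′] x y ⟨
      (x ∨ (x ′ ∧ y)) ′ ≈⟨ ′-cong (modular x y x≤y) ⟨
      (y ∧ (x ∨ x ′)) ′ ≈⟨ [y∧[x∨x′]]′≈y′∨[x∧x′] x y ⟩
      y ′ ∨ (x ∧ x ′)   ∎

    modular-dual : ∀ {x y} → x ≤ y → y ∧ (x ∨ y ′) ≈ x ∨ (y ∧ y ′)
    modular-dual {x} {y} x≤y = begin-equality
      y ∧ (x ∨ y ′)         ≈⟨ ∧-congˡ (∨-comm x (y ′)) ⟩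
      y ∧ (y ′ ∨ x)         ≈⟨ ∧-cong (involutive y) (∨-congˡ (involutive x)) ⟨
      y ′ ′ ∧ (y ′ ∨ x ′ ′) ≈⟨ modular-′ (antitone x≤y) ⟩
      x ′ ′ ∨ (y ′ ∧ y ′ ′) ≈⟨ ∨-cong (involutive x) (trans (∧-comm (y ′) (y ′ ′)) (∧-congʳ (involutive y))) ⟩
      x ∨ (y ∧ y ′)         ∎

    complementModular⇒sp1 : SP1 A
    complementModular⇒sp1 x y x≤y x′∧y≈ = begin-equality
      y ∧ (x ∨ x ′)               ≈⟨ modular x y x≤y ⟩
      x ∨ (x ′ ∧ y)               ≈⟨ ∨-congˡ x′∧y≈ ⟩
      x ∨ ((x ∧ x ′) ∨ (y ∧ y ′)) ≈⟨ ∨-assoc x (x ∧ x ′) (y ∧ y ′) ⟨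
      (x ∨ (x ∧ x ′)) ∨ (y ∧ y ′) ≈⟨ ∨-congʳ (∨-absorbs-∧ x (x ′)) ⟩
      x ∨ (y ∧ y ′)               ∎

    complementModular⇒sp2 : SP2 A
    complementModular⇒sp2 x y x≤y = ≤-antisym ([x∧x′]∨[y∧y′]≤[x′∧y]∧[x′∧y]′ x≤y) (begin
      (x ′ ∧ y) ∧ (x ′ ∧ y) ′  ≤⟨ ∧-greatest (≤-trans (x∧y≤x _ _) (x∧y≤x _ _))
                                   (∧-monotonic (x∧y≤y (x ′) y) (≤-reflexive ([x′∧y]′≈x∨y′ x y))) ⟩
      x ′ ∧ (y ∧ (x ∨ y ′))    ≈⟨ ∧-congˡ (modular-dual x≤y) ⟩
      x ′ ∧ (x ∨ (y ∧ y ′))    ≈⟨ ∧-congˡ (∨-congˡ ([x∨x′]′≈x∧x′ y)) ⟨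
      x ′ ∧ (x ∨ (y ∨ y ′) ′)  ≈⟨ modular-′ (≤-trans x≤y (x≤x∨y y (y ′))) ⟩
      (y ∨ y ′) ′ ∨ (x ∧ x ′)  ≈⟨ ∨-comm ((y ∨ y ′) ′) (x ∧ x ′) ⟩
      (x ∧ x ′) ∨ (y ∨ y ′) ′  ≈⟨ ∨-congˡ ([x∨x′]′≈x∧x′ y) ⟩
      (x ∧ x ′) ∨ (y ∧ y ′)    ∎)

  complementModular⇒sp-orthomodular : ComplementModular → SpOrthomodular A
  complementModular⇒sp-orthomodular modular =
    complementModular⇒sp1 modular , complementModular⇒sp2 modular

  sp-orthomodular⇒complementModular : SpOrthomodular A → ComplementModular
  sp-orthomodular⇒complementModular (sp1 , sp2) x y x≤y =
    ≤-antisym (′-reflects-≤ b′≤c′) (modular-≤ (x ′) x≤y)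
    where
    u v t : Carrier
    u = y ′
    v = x ′ ∧ (x ∨ y ′)
    t = u ′ ∧ v

    u≤v : u ≤ v
    u≤v = ∧-greatest (antitone x≤y) (y≤x∨y x (y ′))

    t≤[x′∧y]∧[x′∧y]′ : t ≤ (x ′ ∧ y) ∧ (x ′ ∧ y) ′
    t≤[x′∧y]∧[x′∧y]′ = ∧-greatest
      (∧-greatest (≤-trans (x∧y≤y _ _) (x∧y≤x _ _)) (≤-trans (x∧y≤x _ _) (≤-reflexive (involutive y))))
      (≤-[x′∧y]′ (≤-trans (x∧y≤y _ _) (x∧y≤y _ _)))

    t≤t′ : t ≤ t ′
    t≤t′ = ≤-trans (≤-trans t≤[x′∧y]∧[x′∧y]′ (x∧y≤y _ _)) (antitone (≤-trans t≤[x′∧y]∧[x′∧y]′ (x∧y≤x _ _)))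

    -- t ≤ t ′ unfolds to t ∧ t ′ ≈ t, so SP2 for u ≤ v supplies the hypothesis of SP1.
    sp1-u-v : v ∧ (u ∨ u ′) ≈ u ∨ (v ∧ v ′)
    sp1-u-v = sp1 u v u≤v (sym (trans (sp2 u v u≤v) t≤t′))

    v≤u∨u′ : v ≤ u ∨ u ′
    v≤u∨u′ = ≤-trans (x∧y≤y _ _)
      (∨-least (≤-trans x≤y (≤-trans (≤-reflexive (sym (involutive y))) (y≤x∨y _ _))) (x≤x∨y _ _))

    v∧v′≤c′ : v ∧ v ′ ≤ y ′ ∨ (x ∧ x ′)
    v∧v′≤c′ = begin
      v ∧ v ′                 ≤⟨ y≤x∨y (u ∧ u ′) (v ∧ v ′) ⟩
      (u ∧ u ′) ∨ (v ∧ v ′)   ≈⟨ sp2 u v u≤v ⟩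
      t ∧ t ′                 ≤⟨ x∧y≤x t (t ′) ⟩
      t                       ≤⟨ t≤[x′∧y]∧[x′∧y]′ ⟩
      (x ′ ∧ y) ∧ (x ′ ∧ y) ′ ≈⟨ sp2 x y x≤y ⟨
      (x ∧ x ′) ∨ (y ∧ y ′)   ≤⟨ ∨-least (y≤x∨y _ _) (≤-trans (x∧y≤y _ _) (x≤x∨y _ _)) ⟩
      y ′ ∨ (x ∧ x ′)         ∎

    b′≤c′ : (x ∨ (x ′ ∧ y)) ′ ≤ (y ∧ (x ∨ x ′)) ′
    b′≤c′ = begin
      (x ∨ (x ′ ∧ y)) ′ ≈⟨ [x∨[x′∧y]]′≈x′∧[x∨y′] x y ⟩
      v                 ≈⟨ v≤u∨u′ ⟨
      v ∧ (u ∨ u ′)     ≈⟨ sp1-u-v ⟩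
      u ∨ (v ∧ v ′)     ≤⟨ ∨-least (x≤x∨y u (x ∧ x ′)) v∧v′≤c′ ⟩
      y ′ ∨ (x ∧ x ′)   ≈⟨ [y∧[x∨x′]]′≈y′∨[x∧x′] x y ⟨
      (y ∧ (x ∨ x ′)) ′ ∎

theorem3p4 : {c ℓ : Level} (A : PseudoKleeneLattice c ℓ) →
    SpOrthomodular A ⇔
      (∀ x y → PseudoKleeneLattice._≤_ A x y →
        PseudoKleeneLattice._≈_ A
          (PseudoKleeneLattice._∧_ A y (PseudoKleeneLattice._∨_ A x (PseudoKleeneLattice._′ A x)))
          (PseudoKleeneLattice._∨_ A x (PseudoKleeneLattice._∧_ A (PseudoKleeneLattice._′ A x) y)))
theorem3p4 A = mk⇔ sp-orthomodular⇒complementModular complementModular⇒sp-orthomodular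
  where open PseudoKleeneLatticeProperties A
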